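{- (Soundness of the liability fragment of CCSR.) Every formula derivable in the axiomatic system $\mathsf{CCSR}_{LI}$ described in the context is valid.
   Context: Fix a nonempty finite set $Ag$ of agents and a countable set $AP$ of atomic propositions. A coalition is a subset of $Ag$. For a nonempty set $Ac$ of actions and a coalition $A$, a joint action of $A$ is a function $\sigma_A:A\to Ac$; $JA_A$ is the set of these (so $JA_\emptyset=\{\emptyset\}$) and $JA=\bigcup_{A\subseteq Ag}JA_A$. A concurrent game model is $M=(St,Ac,av,out,L)$ where $St$ is a nonempty set of states; $Ac$ a nonempty set of actions; $av$ assigns to each $s\in St$ and coalition $A$ a nonempty set $av(s,A)\subseteq JA_A$ such that for $A\neq\emptyset$, $av(s,A)=\{\bigcup_{a\in A}\sigma_a\mid \sigma_a\in av(s,\{a\})\text{ for each }a\in A\}$ (and $av(s,\emptyset)=\{\emptyset\}$); $out$ assigns to each $s\in St$ and $\sigma\in JA_A$ a set of states with $out(s,\sigma)=\emptyset$ if $\sigma\notin av(s,A)$, $out(s,\sigma)$ a singleton if $A=Ag$ and $\sigma\in av(s,Ag)$, and $out(s,\sigma)=\bigcup\{out(s,\sigma')\mid\sigma'\in av(s,Ag),\ \sigma\subseteq\sigma'\}$ if $A\neq Ag$ and $\sigma\in av(s,A)$; $L:St\to\mathcal P(AP)$. For joint actions $\sigma_A,\sigma_B$ of $A,B$ let $\sigma_A\uplus\sigma_B=\sigma_A\cup\{(b,\beta)\in\sigma_B\mid b\in B\setminus A\}$. $\Phi_{\mathsf{CCSR}}$: $\phi::=p\mid\top\mid\neg\phi\mid(\phi\wedge\phi)\mid\mathsf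 C(A,\phi;B,\phi)$; $M,s\models\mathsf C(A,\phi;B,\psi)$ iff there is $\sigma_A\in av(s,A)$ with $M,t\models\phi$ for all $t\in out(s,\sigma_A)$ and there is $\sigma_B\in av(s,B)$ with $M,t\models\psi$ for all $t\in out(s,\sigma_A\uplus\sigma_B)$; booleans standard. $\mathsf C^d(A,\phi;B,\psi):=\neg\mathsf C(A,\neg\phi;B,\neg\psi)$. Valid = true at every pointed concurrent game model. $\Phi_{\mathsf{CCSR}_{LI}}$: $\phi::=\top\mid\bot\mid p\mid\neg p\mid(\phi\wedge\phi)\mid(\phi\vee\phi)\mid\mathsf C^d(A,\phi;B,\phi)$. System $\mathsf{CCSR}_{LI}$: axioms are the propositional tautologies in $\Phi_{\mathsf{CCSR}_{LI}}$; rules: R1: from $\phi_1,\dots,\phi_n$ infer $\psi$, where $(\phi_1\wedge\dots\wedge\phi_n)\to\psi$ is a propositional tautology; R2: from $\phi$ infer $\mathsf C^d(A,\phi;\emptyset,\bot)$; R3: from $\mathsf C^d(A\cup B,\phi\vee\psi;\emptyset,\bot)\vee\chi$ infer $\mathsf C^d(A,\phi;\emptyset,\bot)\vee\mathsf C^d(B,\psi;\emptyset,\bot)\vee\chi$, where $A\cap B=\emptyset$; R4: from $\mathsf C^d(A,\phi;\emptyset,\bot)\vee\chi$ infer $\mathsf C^d(A,\phi;B,\psi)\vee\chi$; R5: from $\mathsf C^d(A\cup B,\phi\vee\psi;\emptyset,\bot)\vee\chi$ infer $\mathsf C^d(A,\phi;B,\psi)\vee\chi$. -}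

module Defs where

open import Data.Nat using (ℕ; suc)
open import Data.Bool using (Bool; true; false; _∧_; _∨_; not; if_then_else_)
open import Data.Fin using (Fin)
open import Data.Fin.Subset using (Subset; _∈_; _∪_; _∩_) renaming (⊥ to ∅)
open import Data.Vec using (lookup)
open import Data.List using (List)
open import Data.List.Relation.Unary.All using (All)
open import Data.Product using (Σ; _×_)
open import Data.Unit using (⊤)
open import Relation.Nullary using (¬_)
open import Relation.Binary.PropositionalEquality using (_≡_)

Agent : ℕ → Set
Agent n = Fin (suc n)

Coal : ℕ → Set
Coal n = Subset (suc n)

-- A model is given by per-agent availability av(s,{a}) (nonempty) and the
-- outcome function on available full joint actions (a single state);
-- av(s,A) and out(s,σ_A) for arbitrary coalitions are then *defined*
-- exactly by the constraints of the paper (see Av and Out below).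
-- Joint actions of a coalition A are represented by total functions
-- Agent → Ac of which only the values on A matter.

record CGM (n : ℕ) : Set₁ where
  field
    St       : Set
    Ac       : Set
    st-ne    : St
    avail    : St → Agent n → Ac → Set
    avail-ne : ∀ s a → Σ Ac (avail s a)
    out      : St → (Agent n → Ac) → St
    L        : St → ℕ → Bool

module Sem {n : ℕ} (M : CGM n) where
  open CGM M

  JA : Set
  JA = Agent n → Ac

  Av : St → Coal n → JA → Set
  Av s A σ = ∀ a → a ∈ A → avail s a (σ a)

  Out : St → Coal n → JA → St → Set
  Out s A σ t = Σ JA λ σ' → (∀ a → avail s a (σ' a))
                          × (∀ a → a ∈ A → σ' a ≡ σ a)
                          × (out s σ' ≡ t)

  _⊎J_ : ∀ {A : Coal n} → JA → JA → JA
  _⊎J_ {A} σA σB a = if lookup A a then σA a else σB a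

data Fm (n : ℕ) : Set where
  atom : ℕ → Fm n
  ⊤ᶠ   : Fm n
  ¬ᶠ_  : Fm n → Fm n
  _∧ᶠ_ : Fm n → Fm n → Fm n
  C    : Coal n → Fm n → Coal n → Fm n → Fm n

Cᵈ : ∀ {n} → Coal n → Fm n → Coal n → Fm n → Fm n
Cᵈ A φ B ψ = ¬ᶠ C A (¬ᶠ φ) B (¬ᶠ ψ)

module _ {n : ℕ} (M : CGM n) where
  open CGM M
  open Sem M

  sat : St → Fm n → Set
  sat s (atom p)    = L s p ≡ true
  sat s ⊤ᶠ          = ⊤
  sat s (¬ᶠ φ)      = ¬ sat s φ
  sat s (φ ∧ᶠ ψ)    = sat s φ × sat s ψ
  sat s (C A φ B ψ) =
    Σ JA λ σA → Av s A σA × (∀ t → Out s A σA t → sat t φ)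
      × Σ JA λ σB → Av s B σB
          × (∀ t → Out s (A ∪ B) (_⊎J_ {A} σA σB) t → sat t ψ)

Valid : ∀ {n} → Fm n → Set₁
Valid {n} φ = (M : CGM n) (s : CGM.St M) → sat M s φ

data LI (n : ℕ) : Set where
  ⊤ˡ  : LI n
  ⊥ˡ  : LI n
  pos : ℕ → LI n
  neg : ℕ → LI n
  _∧ˡ_ : LI n → LI n → LI n
  _∨ˡ_ : LI n → LI n → LI n
  Cdˡ  : Coal n → LI n → Coal n → LI n → LI n

infixr 5 _∨ˡ_

emb : ∀ {n} → LI n → Fm n
emb ⊤ˡ = ⊤ᶠ
emb ⊥ˡ = ¬ᶠ ⊤ᶠ
emb (pos p) = atom p
emb (neg p) = ¬ᶠ atom p
emb (φ ∧ˡ ψ) = emb φ ∧ᶠ emb ψ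
emb (φ ∨ˡ ψ) = ¬ᶠ ((¬ᶠ emb φ) ∧ᶠ (¬ᶠ emb ψ))
emb (Cdˡ A φ B ψ) = Cᵈ A (emb φ) B (emb ψ)

-- Propositional valuations: atoms and (syntactic) Cᵈ-subformulas are
-- the propositional variables.
CdVal : ℕ → Set
CdVal n = Coal n → LI n → Coal n → LI n → Bool

evalB : ∀ {n} → (ℕ → Bool) → CdVal n → LI n → Bool
evalB vp vc ⊤ˡ = true
evalB vp vc ⊥ˡ = false
evalB vp vc (pos p) = vp p
evalB vp vc (neg p) = not (vp p)
evalB vp vc (φ ∧ˡ ψ) = evalB vp vc φ ∧ evalB vp vc ψ
evalB vp vc (φ ∨ˡ ψ) = evalB vp vc φ ∨ evalB vp vc ψ
evalB vp vc (Cdˡ A φ B ψ) = vc A φ B ψ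

allTrue : ∀ {n} → (ℕ → Bool) → CdVal n → List (LI n) → Bool
allTrue vp vc List.[] = true
allTrue vp vc (φ List.∷ Γ) = evalB vp vc φ ∧ allTrue vp vc Γ

TautImp : ∀ {n} → List (LI n) → LI n → Set
TautImp {n} Γ ψ = (vp : ℕ → Bool) (vc : CdVal n) →
  allTrue vp vc Γ ≡ true → evalB vp vc ψ ≡ true

Taut : ∀ {n} → LI n → Set
Taut {n} φ = (vp : ℕ → Bool) (vc : CdVal n) → evalB vp vc φ ≡ true

data ⊢_ {n : ℕ} : LI n → Set where
  ax : ∀ {φ} → Taut φ → ⊢ φ
  R1 : ∀ {ψ} (Γ : List (LI n)) → All ⊢_ Γ → TautImp Γ ψ → ⊢ ψ
  R2 : ∀ {φ} (A : Coal n) → ⊢ φ → ⊢ Cdˡ A φ ∅ ⊥ˡ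
  R3 : ∀ {φ ψ χ} (A B : Coal n) → A ∩ B ≡ ∅ →
       ⊢ (Cdˡ (A ∪ B) (φ ∨ˡ ψ) ∅ ⊥ˡ ∨ˡ χ) →
       ⊢ (Cdˡ A φ ∅ ⊥ˡ ∨ˡ Cdˡ B ψ ∅ ⊥ˡ ∨ˡ χ)
  R4 : ∀ {φ ψ χ} (A B : Coal n) →
       ⊢ (Cdˡ A φ ∅ ⊥ˡ ∨ˡ χ) → ⊢ (Cdˡ A φ B ψ ∨ˡ χ)
  R5 : ∀ {φ ψ χ} (A B : Coal n) →
       ⊢ (Cdˡ (A ∪ B) (φ ∨ˡ ψ) ∅ ⊥ˡ ∨ˡ χ) → ⊢ (Cdˡ A φ B ψ ∨ˡ χ)

-- Rules R2-R5 rest on three properties of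
-- concurrent game models: every available joint action has an outcome; available joint
-- actions of A and of B combine (A's choices taking precedence) into an available joint
-- action of A ∪ B; and every outcome of the combination is an outcome of A's action and,
-- when A and B are disjoint, also of B's. Here s ⊨ Cᵈ(A, φ; ∅, ⊥) says exactly that A
-- cannot force ¬φ, so R3 expresses that disjoint coalitions forcing ¬φ and ¬ψ together
-- force ¬(φ ∨ ψ).
-- For R1, a tautology is evaluated under the valuation that reads atoms off the labelling
-- and the outermost Cᵈ-subformulas off their truth at the state. Constructively such a
-- valuation exists only under a double negation, which is harmless because truth of every
-- formula of the liability fragment is ¬¬-stable.
module Submission where

open import Data.Nat using (ℕ)
import Data.Nat as ℕ
open import Data.Bool using (Bool; true; false; _∧_; _∨_; not)
open import Data.Bool.Properties using (not-involutive)
import Data.Bool as Bool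
open import Data.Fin.Subset using (_∈_; _∉_; _∪_; _∩_) renaming (⊥ to ∅)
open import Data.Fin.Subset.Properties using (_∈?_; ∈⊤; ∉⊥; x∈p∩q⁺; x∈p∪q⁻; x∈p∪q⁺)
open import Data.Vec using (lookup)
open import Data.Vec.Properties using (≡-dec; lookup⇒[]=; []=⇒lookup)
open import Data.List using (List; []; _∷_; _++_; concatMap)
open import Data.List.Relation.Unary.All as All using (All; []; _∷_)
open import Data.List.Relation.Unary.All.Properties using (++⁻ˡ; ++⁻ʳ; concat⁻; map⁻)
open import Data.List.Membership.Propositional using () renaming (_∈_ to _∈ₗ_)
import Data.List.Membership.DecPropositional as DecMembership
open import Data.Product using (Σ; _×_; _,_; proj₁; proj₂; uncurry)
open import Data.Sum using (inj₁; inj₂; [_,_]′)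
open import Data.Unit using (tt)
open import Function using (_∘_; id; flip)
open import Level using (0ℓ)
open import Relation.Nullary using (¬_; Dec; yes; no; does; proof; contradiction)
open import Relation.Nullary.Decidable using (map′; _×-dec_; ¬¬-excluded-middle; decidable-stable)
open import Relation.Nullary.Negation using (Stable; negated-stable; ¬¬-map; ¬¬-Monad)
open import Relation.Nullary.Reflects using (Reflects; ofʸ; ofⁿ; ¬-reflects; _×-reflects_; det)
open import Relation.Binary.Definitions using (DecidableEquality)
open import Relation.Binary.PropositionalEquality using (_≡_; refl; sym; trans; cong; cong₂; subst)
open import Defs

shape : ∀ {n} → LI n → ℕ
shape ⊤ˡ = 0
shape ⊥ˡ = 1
shape (pos _) = 2
shape (neg _) = 3
shape (_ ∧ˡ _) = 4
shape (_ ∨ˡ _) = 5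
shape (Cdˡ _ _ _ _) = 6

-- Comparing shapes first leaves only the clauses for equal constructors.
_≟_ : ∀ {n} → DecidableEquality (LI n)
φ ≟ ψ with shape φ ℕ.≟ shape ψ
... | no shapes≢ = no (shapes≢ ∘ cong shape)
⊤ˡ ≟ ⊤ˡ | yes _ = yes refl
⊥ˡ ≟ ⊥ˡ | yes _ = yes refl
pos p ≟ pos q | yes _ = map′ (cong pos) (λ { refl → refl }) (p ℕ.≟ q)
neg p ≟ neg q | yes _ = map′ (cong neg) (λ { refl → refl }) (p ℕ.≟ q)
(φ ∧ˡ ψ) ≟ (φ′ ∧ˡ ψ′) | yes _ =
  map′ (uncurry (cong₂ _∧ˡ_)) (λ { refl → refl , refl }) (φ ≟ φ′ ×-dec ψ ≟ ψ′)
(φ ∨ˡ ψ) ≟ (φ′ ∨ˡ ψ′) | yes _ =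
  map′ (uncurry (cong₂ _∨ˡ_)) (λ { refl → refl , refl }) (φ ≟ φ′ ×-dec ψ ≟ ψ′)
Cdˡ A φ B ψ ≟ Cdˡ A′ φ′ B′ ψ′ | yes _ =
  map′ (λ { (refl , refl , refl , refl) → refl }) (λ { refl → refl , refl , refl , refl })
       (≡-dec Bool._≟_ A A′ ×-dec φ ≟ φ′ ×-dec ≡-dec Bool._≟_ B B′ ×-dec ψ ≟ ψ′)

modalAtoms : ∀ {n} → LI n → List (LI n)
modalAtoms (φ ∧ˡ ψ) = modalAtoms φ ++ modalAtoms ψ
modalAtoms (φ ∨ˡ ψ) = modalAtoms φ ++ modalAtoms ψ
modalAtoms (Cdˡ A φ B ψ) = Cdˡ A φ B ψ ∷ []
modalAtoms _ = []

cdValuation : ∀ {n} → (LI n → Bool) → CdVal n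
cdValuation f A φ B ψ = f (Cdˡ A φ B ψ)

not-∧-not : ∀ a b → not (not a ∧ not b) ≡ a ∨ b
not-∧-not true b = refl
not-∧-not false b = not-involutive b

≡true-reflects : ∀ b → Reflects (b ≡ true) b
≡true-reflects true = ofʸ refl
≡true-reflects false = ofⁿ λ ()

reflects-true : ∀ {A : Set} {b} → Reflects A b → b ≡ true → A
reflects-true (ofʸ a) _ = a

-- s ⊨ (φ ∨ˡ ψ) unfolds to (s ⊨ φ) ∨ᶜ (s ⊨ ψ), as emb encodes ∨ by ¬ and ∧.
_∨ᶜ_ : Set → Set → Set
X ∨ᶜ Y = ¬ (¬ X × ¬ Y)

¬∨ᶜ-intro : ∀ {X Y : Set} → ¬ X → ¬ Y → ¬ (X ∨ᶜ Y)
¬∨ᶜ-intro ¬x ¬y x∨y = x∨y (¬x , ¬y)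

∨ᶜ-mapˡ : ∀ {X Y Z : Set} → (X → Y) → X ∨ᶜ Z → Y ∨ᶜ Z
∨ᶜ-mapˡ x⇒y x∨z (¬y , ¬z) = x∨z (¬y ∘ x⇒y , ¬z)

∨ᶜ-assocʳ : ∀ {X Y Z : Set} → (X ∨ᶜ Y) ∨ᶜ Z → X ∨ᶜ (Y ∨ᶜ Z)
∨ᶜ-assocʳ [x∨y]∨z (¬x , ¬[y∨z]) = ¬[y∨z] λ (¬y , ¬z) → [x∨y]∨z (¬∨ᶜ-intro ¬x ¬y , ¬z)

module GameModel {n : ℕ} (M : CGM n) where
  open CGM M
  open Sem M

  ⊎J-agreeˡ : ∀ {A : Coal n} σA σB {a} → a ∈ A → _⊎J_ {A} σA σB a ≡ σA a
  ⊎J-agreeˡ _ _ a∈A rewrite []=⇒lookup a∈A = refl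

  ⊎J-agreeʳ : ∀ {A : Coal n} σA σB {a} → a ∉ A → _⊎J_ {A} σA σB a ≡ σB a
  ⊎J-agreeʳ {A} _ _ {a} a∉A with lookup A a in eq
  ... | true = contradiction (lookup⇒[]= a A eq) a∉A
  ... | false = refl

  Av-⊎J : ∀ {s A B σA σB} → Av s A σA → Av s B σB → Av s (A ∪ B) (_⊎J_ {A} σA σB)
  Av-⊎J {s} {A} {B} {σA} {σB} avA avB a a∈A∪B with a ∈? A
  ... | yes a∈A = subst (avail s a) (sym (⊎J-agreeˡ σA σB a∈A)) (avA a a∈A)
  ... | no a∉A = subst (avail s a) (sym (⊎J-agreeʳ σA σB a∉A))
                   (avB a ([ flip contradiction a∉A , id ]′ (x∈p∪q⁻ A B a∈A∪B)))

  Out-restrict : ∀ {s A A′ σ τ t} → (∀ {a} → a ∈ A → a ∈ A′ × τ a ≡ σ a) →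
                 Out s A′ τ t → Out s A σ t
  Out-restrict restricts (σ′ , full , agree , outcome) =
    σ′ , full , (λ a a∈A → let a∈A′ , τa≡σa = restricts a∈A in trans (agree a a∈A′) τa≡σa) ,
    outcome

  Out-⊎Jˡ : ∀ {s A B σA σB t} → Out s (A ∪ B) (_⊎J_ {A} σA σB) t → Out s A σA t
  Out-⊎Jˡ {σA = σA} {σB} = Out-restrict λ a∈A → x∈p∪q⁺ (inj₁ a∈A) , ⊎J-agreeˡ σA σB a∈A

  Out-⊎Jʳ : ∀ {s A B σA σB t} → A ∩ B ≡ ∅ → Out s (A ∪ B) (_⊎J_ {A} σA σB) t → Out s B σB t
  Out-⊎Jʳ {σA = σA} {σB} disjoint = Out-restrict λ {a} a∈B →
    x∈p∪q⁺ (inj₂ a∈B) , ⊎J-agreeʳ σA σB (λ a∈A → ∉⊥ (subst (a ∈_) disjoint (x∈p∩q⁺ (a∈A , a∈B))))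

  Out-nonempty : ∀ {s A σ} → Av s A σ → Σ St (Out s A σ)
  Out-nonempty {s} {A} {σ} av = out s σ′ , σ′ , full , (λ a a∈A → ⊎J-agreeˡ σ default a∈A) , refl
    where
    default : JA
    default a = proj₁ (avail-ne s a)
    σ′ : JA
    σ′ = _⊎J_ {A} σ default
    full : ∀ a → avail s a (σ′ a)
    full a = Av-⊎J av (λ a _ → proj₂ (avail-ne s a)) a (x∈p∪q⁺ (inj₂ ∈⊤))

  Forces : St → Coal n → (St → Set) → Set
  Forces s A P = Σ JA λ σ → Av s A σ × (∀ t → Out s A σ t → P t)

  Forces-satisfiable : ∀ {s A P} → Forces s A P → Σ St P
  Forces-satisfiable (σ , av , forced) = let t , o = Out-nonempty av in t , forced t o

  Forces-map : ∀ {s A} {P Q : St → Set} → (∀ {t} → P t → Q t) → Forces s A P → Forces s A Q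
  Forces-map P⇒Q (σ , av , forced) = σ , av , λ t o → P⇒Q (forced t o)

  Forces-⊎J : ∀ {s A B σA σB} {P Q : St → Set} → Av s A σA → Av s B σB →
              (∀ t → Out s A σA t → P t) → (∀ t → Out s (A ∪ B) (_⊎J_ {A} σA σB) t → Q t) →
              Forces s (A ∪ B) (λ t → P t × Q t)
  Forces-⊎J {A = A} {σA = σA} {σB} avA avB forcedP forcedQ =
    _⊎J_ {A} σA σB , Av-⊎J avA avB , λ t o → forcedP t (Out-⊎Jˡ o) , forcedQ t o

  Forces-∪ : ∀ {s A B} {P Q : St → Set} → A ∩ B ≡ ∅ →
             Forces s A P → Forces s B Q → Forces s (A ∪ B) (λ t → P t × Q t)
  Forces-∪ disjoint (σA , avA , forcedP) (σB , avB , forcedQ) =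
    Forces-⊎J avA avB forcedP (λ t o → forcedQ t (Out-⊎Jʳ disjoint o))

  _⊨_ : St → LI n → Set
  s ⊨ χ = sat M s (emb χ)

  ⊨Cd∅-intro : ∀ {s} A φ → ¬ Forces s A (λ t → ¬ t ⊨ φ) → s ⊨ Cdˡ A φ ∅ ⊥ˡ
  ⊨Cd∅-intro A φ ¬forces (σ , av , forced , _) = ¬forces (σ , av , forced)

  ⊨Cd∅-elim : ∀ {s} A φ → s ⊨ Cdˡ A φ ∅ ⊥ˡ → ¬ Forces s A (λ t → ¬ t ⊨ φ)
  ⊨Cd∅-elim A φ ⊨Cd (σ , av , forced) =
    ⊨Cd (σ , av , forced , σ , (λ a a∈∅ → contradiction a∈∅ ∉⊥) , λ _ _ ¬⊤ → ¬⊤ tt)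

  valid⇒⊨Cd∅ : ∀ {s} A φ → (∀ t → t ⊨ φ) → s ⊨ Cdˡ A φ ∅ ⊥ˡ
  valid⇒⊨Cd∅ A φ ⊨φ = ⊨Cd∅-intro A φ λ forces →
    let t , ⊭φ = Forces-satisfiable forces in ⊭φ (⊨φ t)

  ⊨Cd∅⇒⊨Cd : ∀ {s} A φ B ψ → s ⊨ Cdˡ A φ ∅ ⊥ˡ → s ⊨ Cdˡ A φ B ψ
  ⊨Cd∅⇒⊨Cd A φ B ψ ⊨Cd (σ , av , forced , _) = ⊨Cd∅-elim A φ ⊨Cd (σ , av , forced)

  ⊨Cd∪⇒⊨Cd : ∀ {s} A B φ ψ → s ⊨ Cdˡ (A ∪ B) (φ ∨ˡ ψ) ∅ ⊥ˡ → s ⊨ Cdˡ A φ B ψ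
  ⊨Cd∪⇒⊨Cd A B φ ψ ⊨Cd (σA , avA , forcedA , σB , avB , forcedB) =
    ⊨Cd∅-elim (A ∪ B) (φ ∨ˡ ψ) ⊨Cd
      (Forces-map (uncurry ¬∨ᶜ-intro) (Forces-⊎J avA avB forcedA forcedB))

  ⊨Cd∪⇒⊨Cd∨⊨Cd : ∀ {s} A B φ ψ → A ∩ B ≡ ∅ → s ⊨ Cdˡ (A ∪ B) (φ ∨ˡ ψ) ∅ ⊥ˡ →
                 s ⊨ (Cdˡ A φ ∅ ⊥ˡ ∨ˡ Cdˡ B ψ ∅ ⊥ˡ)
  ⊨Cd∪⇒⊨Cd∨⊨Cd A B φ ψ disjoint ⊨Cd (⊭CdA , ⊭CdB) =
    ⊭CdA (⊨Cd∅-intro A φ λ forcesA → ⊭CdB (⊨Cd∅-intro B ψ λ forcesB →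
      ⊨Cd∅-elim (A ∪ B) (φ ∨ˡ ψ) ⊨Cd
        (Forces-map (uncurry ¬∨ᶜ-intro) (Forces-∪ disjoint forcesA forcesB))))

  module AtState (s : St) where
    open DecMembership (_≟_ {n}) using () renaming (_∈?_ to _∈ₗ?_)

    ⊨-stable : ∀ χ → Stable (s ⊨ χ)
    ⊨-stable ⊤ˡ _ = tt
    ⊨-stable ⊥ˡ = negated-stable
    ⊨-stable (pos p) = decidable-stable (L s p Bool.≟ true)
    ⊨-stable (neg p) = negated-stable
    ⊨-stable (φ ∧ˡ ψ) ¬¬⊨φ∧ψ =
      ⊨-stable φ (¬¬-map proj₁ ¬¬⊨φ∧ψ) , ⊨-stable ψ (¬¬-map proj₂ ¬¬⊨φ∧ψ)
    ⊨-stable (φ ∨ˡ ψ) = negated-stable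
    ⊨-stable (Cdˡ A φ B ψ) = negated-stable

    Reflecting : (LI n → Bool) → LI n → Set
    Reflecting f χ = Reflects (s ⊨ χ) (f χ)

    eval : (LI n → Bool) → LI n → Bool
    eval f = evalB (L s) (cdValuation f)

    truth : ∀ f χ → All (Reflecting f) (modalAtoms χ) → Reflecting (eval f) χ
    truth f ⊤ˡ _ = ofʸ tt
    truth f ⊥ˡ _ = ¬-reflects (ofʸ tt)
    truth f (pos p) _ = ≡true-reflects (L s p)
    truth f (neg p) _ = ¬-reflects (≡true-reflects (L s p))
    truth f (φ ∧ˡ ψ) rs =
      truth f φ (++⁻ˡ (modalAtoms φ) rs) ×-reflects truth f ψ (++⁻ʳ (modalAtoms φ) rs)
    truth f (φ ∨ˡ ψ) rs =
      subst (Reflects (s ⊨ (φ ∨ˡ ψ))) (not-∧-not (eval f φ) (eval f ψ))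
      (¬-reflects (¬-reflects (truth f φ (++⁻ˡ (modalAtoms φ) rs))
                   ×-reflects ¬-reflects (truth f ψ (++⁻ʳ (modalAtoms φ) rs))))
    truth f (Cdˡ A φ B ψ) (r ∷ []) = r

    ¬¬-reflectingValuation : ∀ ks → ¬ ¬ Σ (LI n → Bool) (λ f → All (Reflecting f) ks)
    ¬¬-reflectingValuation ks =
      ¬¬-map (λ decisions → valuation decisions , All.tabulate (reflecting decisions))
             (All.sequenceM 0ℓ ¬¬-Monad (All.tabulate λ _ → ¬¬-excluded-middle))
      where
      valuation : All (λ χ → Dec (s ⊨ χ)) ks → LI n → Bool
      valuation decisions χ with χ ∈ₗ? ks
      ... | yes χ∈ks = does (All.lookup decisions χ∈ks)
      ... | no _ = false

      reflecting : ∀ decisions {χ} → χ ∈ₗ ks → Reflecting (valuation decisions) χ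
      reflecting decisions {χ} χ∈ks with χ ∈ₗ? ks
      ... | yes χ∈ks′ = proof (All.lookup decisions χ∈ks′)
      ... | no χ∉ks = contradiction χ∈ks χ∉ks

    allTrue-intro : ∀ {vc Γ} → All (Reflecting (evalB (L s) vc)) Γ →
                    All (s ⊨_) Γ → allTrue (L s) vc Γ ≡ true
    allTrue-intro [] [] = refl
    allTrue-intro (r ∷ rs) (⊨γ ∷ ⊨Γ) = cong₂ _∧_ (sym (det (ofʸ ⊨γ) r)) (allTrue-intro rs ⊨Γ)

    tautImp-sound : ∀ {Γ ψ} → TautImp Γ ψ → All (s ⊨_) Γ → s ⊨ ψ
    tautImp-sound {Γ} {ψ} taut ⊨Γ = ⊨-stable ψ λ ⊭ψ →
      ¬¬-reflectingValuation (concatMap modalAtoms (ψ ∷ Γ)) λ (f , rs) →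
        ⊭ψ (conclude f (All.map (truth f _) (map⁻ (concat⁻ rs))))
      where
      conclude : ∀ f → All (Reflecting (eval f)) (ψ ∷ Γ) → s ⊨ ψ
      conclude f (rψ ∷ rΓ) = reflects-true rψ (taut (L s) (cdValuation f) (allTrue-intro rΓ ⊨Γ))

open GameModel

mutual
  sound : ∀ {n} {φ : LI n} → ⊢ φ → Valid (emb φ)
  sound (ax taut) M s = AtState.tautImp-sound M s (λ vp vc _ → taut vp vc) []
  sound (R1 Γ ⊢Γ taut) M s = AtState.tautImp-sound M s taut (sound-all ⊢Γ M s)
  sound (R2 {φ} A ⊢φ) M s = valid⇒⊨Cd∅ M A φ (sound ⊢φ M)
  sound (R3 {φ} {ψ} A B disjoint ⊢φ) M s =
    ∨ᶜ-assocʳ (∨ᶜ-mapˡ (⊨Cd∪⇒⊨Cd∨⊨Cd M A B φ ψ disjoint) (sound ⊢φ M s))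
  sound (R4 {φ} {ψ} A B ⊢φ) M s = ∨ᶜ-mapˡ (⊨Cd∅⇒⊨Cd M A φ B ψ) (sound ⊢φ M s)
  sound (R5 {φ} {ψ} A B ⊢φ) M s = ∨ᶜ-mapˡ (⊨Cd∪⇒⊨Cd M A B φ ψ) (sound ⊢φ M s)

  sound-all : ∀ {n} {Γ : List (LI n)} → All ⊢_ Γ → (M : CGM n) (s : CGM.St M) → All (_⊨_ M s) Γ
  sound-all [] M s = []
  sound-all (⊢γ ∷ ⊢Γ) M s = sound ⊢γ M s ∷ sound-all ⊢Γ M s

mainTheorem3 : (n : ℕ) (φ : LI n) → ⊢ φ → Valid (emb φ)
mainTheorem3 n φ = sound
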